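{- Let $b(n)$ be defined by $\sum_{n\ge0} b(n)q^n=\mathcal{B}(q)$. Let $p\ge5$ be a prime with $\left(\frac{ -3}{p}\right)_L=-1$. Then for all integers $n,k\ge0$ with $p\nmid n$, \[b\left(3p^{2k+1}n+\frac{p^{2k+2}-1}{2}\right)\equiv0\pmod 2.\]
   Context: $(a;q)_n=\prod_{j=0}^{n-1}(1-aq^j)$ for $|q|<1$. McIntosh's second order mock theta function is $\mathcal{B}(q)=\sum_{n\ge0}\frac{q^n(-q;q^2)_n}{(q;q^2)_{n+1}}$. $\left(\frac{\cdot}{p}\right)_L$ denotes the Legendre symbol. -}

module Defs where

open import Data.Bool using (Bool; true; false; if_then_else_)
open import Data.Nat using (ℕ; zero; suc; _+_; _*_; _∸_; _≡ᵇ_)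
open import Data.Nat.DivMod using (_%_)
open import Data.List using (List; map; upTo)
open import Data.Nat.ListAction using (sum)
open import Data.Nat.Divisibility using (_∣_)
open import Relation.Nullary using (¬_)

-- Formal power series in q with natural-number coefficients, represented
-- by their coefficient function.  All series occurring in 𝓑(q) have
-- nonnegative integer coefficients, so ℕ is exact.
Series : Set
Series = ℕ → ℕ

_⊛_ : Series → Series → Series
(f ⊛ g) n = sum (map (λ i → f i * g (n ∸ i)) (upTo (suc n)))

qpow : ℕ → Series
qpow m n = if n ≡ᵇ m then 1 else 0

onePlusQ : ℕ → Series
onePlusQ zero n = if n ≡ᵇ 0 then 2 else 0
onePlusQ (suc m) n = if n ≡ᵇ 0 then 1 else (if n ≡ᵇ suc m then 1 else 0)

-- 1 / (1 - q^m) = Σ_{t ≥ 0} q^{m t}, for m ≥ 1 (used with m odd)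
geomInv : ℕ → Series
geomInv m n = if n % suc (m ∸ 1) ≡ᵇ 0 then 1 else 0

negQPoch : ℕ → Series
negQPoch zero = qpow 0
negQPoch (suc n) = negQPoch n ⊛ onePlusQ (2 * n + 1)

invQPoch : ℕ → Series
invQPoch zero = qpow 0
invQPoch (suc n) = invQPoch n ⊛ geomInv (2 * n + 1)

-- the n-th summand of 𝓑(q):  q^n (-q;q^2)_n / (q;q^2)_{n+1}
term : ℕ → Series
term n = qpow n ⊛ (negQPoch n ⊛ invQPoch (suc n))

-- b(N) = coefficient of q^N in 𝓑(q) = Σ_{n ≥ 0} term n.
-- term n is divisible by q^n, so only n ≤ N contribute to q^N.
b : ℕ → ℕ
b N = sum (map (λ n → term n N) (upTo (suc N)))

-- Legendre symbol condition (a / p)_L = -1 for an odd prime p with p ∤ a: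
-- a is a quadratic non-residue mod p.  For a = -3 (with p ≥ 5, so p ∤ -3)
-- this says: there is no integer x with x² ≡ -3 (mod p), i.e. p ∤ x² + 3.
-- It suffices to range x over ℕ since squares mod p only depend on x mod p.
legendreMinus3IsMinusOne : ℕ → Set
legendreMinus3IsMinusOne p = (x : ℕ) → ¬ (p ∣ x * x + 3)

{-# OPTIONS --safe #-}
module Submission where

-- Modulo 2 the factors 1 + q^(2j+1) of (-q;q²)_n cancel against 1/(1 - q^(2j+1)), since
-- (1 + x)/(1 - x) = 1 + 2x/(1 - x).  Hence the n-th summand of 𝓑(q) is congruent to
-- q^n/(1 - q^(2n+1)), and b(N) is congruent to the number of pairs (n, t) with
-- (2n+1)(2t+1) = 2N+1, i.e. to the number of divisors of 2N+1.  Divisors pair off as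
-- d ↔ (2N+1)/d, so b(N) is even unless 2N+1 is a square.  In the theorem
-- 2N+1 = p^(2k+1)(p + 6n) with p ∤ p + 6n, which is not a square.


open import Defs
open import Algebra.Bundles using (CommutativeMonoid)
open import Algebra.Definitions using (Congruent₂)
open import Algebra.Structures using (IsCommutativeMonoid)
import Algebra.Properties.CommutativeSemigroup as CommutativeSemigroupProperties
open import Data.Bool using (true; false; if_then_else_)
open import Data.Empty using (⊥-elim)
open import Data.List using ([_]; _++_; applyUpTo; upTo)
open import Data.List.Properties using (applyUpTo-∷ʳ; map-upTo; map-cong)
open import Data.Nat
open import Data.Nat.DivMod
open import Data.Nat.Divisibility using (_∣_; divides; ∣-refl; ∣⇒≤; ∣m+n∣m⇒∣n; m%n≡0⇒n∣m)
open import Data.Nat.ListAction using (sum)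
open import Data.Nat.ListAction.Properties using (sum-++)
open import Data.Nat.Primality using (Prime; euclidsLemma; prime⇒irreducible; prime⇒nonZero)
open import Data.Nat.Properties
open import Data.Nat.Tactic.RingSolver using (solve-∀)
open import Data.Product using (_,_)
open import Data.Sum using (inj₁; inj₂; reduce)
open import Function using (_∘_; _⇔_; mk⇔; Equivalence)
open import Level using (0ℓ)
open import Relation.Binary.Core using (Rel)
open import Relation.Binary.Structures using (IsEquivalence)
open import Relation.Binary.PropositionalEquality
  using (_≡_; _≢_; _≗_; refl; sym; trans; cong; cong₂; ≢-sym; module ≡-Reasoning)
import Relation.Binary.Reasoning.Setoid as SetoidReasoning
open import Relation.Nullary using (¬_; yes; no)

open CommutativeSemigroupProperties +-commutativeSemigroup using ()
  renaming (interchange to +-interchange)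

∑< : ℕ → (ℕ → ℕ) → ℕ
∑< L f = sum (applyUpTo f L)

infix 5 ∑<
syntax ∑< L (λ i → e) = ∑[ i < L ] e

∑<-cong : ∀ L {f g} → (∀ {i} → i < L → f i ≡ g i) → ∑< L f ≡ ∑< L g
∑<-cong zero    eq = refl
∑<-cong (suc L) eq = cong₂ _+_ (eq z<s) (∑<-cong L (eq ∘ s<s))

∑<-zero : ∀ L {f} → (∀ {i} → i < L → f i ≡ 0) → ∑< L f ≡ 0
∑<-zero zero    eq = refl
∑<-zero (suc L) eq = cong₂ _+_ (eq z<s) (∑<-zero L (eq ∘ s<s))

∑<-distrib-+ : ∀ L f g → (∑[ i < L ] (f i + g i)) ≡ ∑< L f + ∑< L g
∑<-distrib-+ zero    f g = refl
∑<-distrib-+ (suc L) f g = trans (cong (f 0 + g 0 +_) (∑<-distrib-+ L (f ∘ suc) (g ∘ suc)))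
                                 (+-interchange (f 0) (g 0) _ _)

*-distribˡ-∑< : ∀ c L f → c * ∑< L f ≡ (∑[ i < L ] c * f i)
*-distribˡ-∑< c zero    f = *-zeroʳ c
*-distribˡ-∑< c (suc L) f = trans (*-distribˡ-+ c (f 0) _) (cong (c * f 0 +_) (*-distribˡ-∑< c L (f ∘ suc)))

∑<-suc : ∀ L f → ∑< (suc L) f ≡ ∑< L f + f L
∑<-suc L f = begin
  sum (applyUpTo f (suc L))       ≡⟨ cong sum (applyUpTo-∷ʳ f L) ⟨
  sum (applyUpTo f L ++ [ f L ])  ≡⟨ sum-++ (applyUpTo f L) [ f L ] ⟩
  ∑< L f + (f L + 0)              ≡⟨ cong (∑< L f +_) (+-identityʳ (f L)) ⟩
  ∑< L f + f L                    ∎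
  where open ≡-Reasoning

∑<-reverse : ∀ L f → ∑< L f ≡ (∑[ i < L ] f (L ∸ suc i))
∑<-reverse zero    f = refl
∑<-reverse (suc L) f = begin
  f 0 + ∑< L (f ∘ suc)                    ≡⟨ cong (f 0 +_) (∑<-reverse L (f ∘ suc)) ⟩
  f 0 + (∑[ i < L ] f (suc (L ∸ suc i)))  ≡⟨ cong (f 0 +_) (∑<-cong L (λ i<L → cong f (+-∸-assoc 1 i<L))) ⟨
  f 0 + (∑[ i < L ] f (L ∸ i))            ≡⟨ +-comm (f 0) _ ⟩
  (∑[ i < L ] f (L ∸ i)) + f 0            ≡⟨ cong (λ j → (∑[ i < L ] f (L ∸ i)) + f j) (n∸n≡0 L) ⟨
  (∑[ i < L ] f (L ∸ i)) + f (L ∸ L)      ≡⟨ ∑<-suc L (λ i → f (L ∸ i)) ⟨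
  (∑[ i < suc L ] f (L ∸ i))              ∎
  where open ≡-Reasoning

∑<-swap : ∀ L K (f : ℕ → ℕ → ℕ) → (∑[ i < L ] ∑[ j < K ] f i j) ≡ (∑[ j < K ] ∑[ i < L ] f i j)
∑<-swap zero    K f = sym (∑<-zero K (λ _ → refl))
∑<-swap (suc L) K f = trans (cong (∑< K (f 0) +_) (∑<-swap L K (f ∘ suc)))
                            (sym (∑<-distrib-+ K (f 0) (λ j → ∑[ i < L ] f (suc i) j)))

module _ {d : ℕ} .{{_ : NonZero d}} where

  +-cong-% : ∀ {a a' b b'} → a % d ≡ a' % d → b % d ≡ b' % d → (a + b) % d ≡ (a' + b') % d
  +-cong-% {a} {a'} {b} {b'} a≡a' b≡b' = begin
    (a + b) % d                ≡⟨ %-distribˡ-+ a b d ⟩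
    (a % d + b % d) % d        ≡⟨ cong₂ (λ x y → (x + y) % d) a≡a' b≡b' ⟩
    (a' % d + b' % d) % d      ≡⟨ %-distribˡ-+ a' b' d ⟨
    (a' + b') % d              ∎
    where open ≡-Reasoning

  *-cong-% : ∀ {a a' b b'} → a % d ≡ a' % d → b % d ≡ b' % d → (a * b) % d ≡ (a' * b') % d
  *-cong-% {a} {a'} {b} {b'} a≡a' b≡b' = begin
    (a * b) % d                ≡⟨ %-distribˡ-* a b d ⟩
    (a % d * (b % d)) % d      ≡⟨ cong₂ (λ x y → (x * y) % d) a≡a' b≡b' ⟩
    (a' % d * (b' % d)) % d    ≡⟨ %-distribˡ-* a' b' d ⟨
    (a' * b') % d              ∎
    where open ≡-Reasoning

  ∑<-cong-% : ∀ L {f g} → (∀ {i} → i < L → f i % d ≡ g i % d) → ∑< L f % d ≡ ∑< L g % d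
  ∑<-cong-% zero    eq = refl
  ∑<-cong-% (suc L) eq = +-cong-% (eq z<s) (∑<-cong-% L (eq ∘ s<s))

[m+n+n]%2≡m%2 : ∀ m n → (m + n + n) % 2 ≡ m % 2
[m+n+n]%2≡m%2 m n = trans (cong (_% 2) (m+n+n≡m+n*2 m n)) ([m+kn]%n≡m%n m n 2)
  where
  m+n+n≡m+n*2 : ∀ m n → m + n + n ≡ m + n * 2
  m+n+n≡m+n*2 = solve-∀

-- qpow m n ≡ δ n m  and  geomInv (suc m) n ≡ δ (n % suc m) 0  hold definitionally.
δ : ℕ → ℕ → ℕ
δ m n = if m ≡ᵇ n then 1 else 0

δ-≡ : ∀ {m n} → m ≡ n → δ m n ≡ 1
δ-≡ {m} {n} m≡n with m ≡ᵇ n | ≡⇒≡ᵇ m n m≡n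
... | true | _ = refl

δ-≢ : ∀ {m n} → m ≢ n → δ m n ≡ 0
δ-≢ {m} {n} m≢n with m ≡ᵇ n | ≡ᵇ⇒≡ m n
... | true  | m≡n = ⊥-elim (m≢n (m≡n _))
... | false | _   = refl

δ-cong : ∀ {m n m' n'} → (m ≡ n ⇔ m' ≡ n') → δ m n ≡ δ m' n'
δ-cong {m} {n} m≡n⇔m'≡n' with m ≟ n
... | yes m≡n = trans (δ-≡ m≡n) (sym (δ-≡ (Equivalence.to m≡n⇔m'≡n' m≡n)))
... | no  m≢n = trans (δ-≢ m≢n) (sym (δ-≢ (m≢n ∘ Equivalence.from m≡n⇔m'≡n')))

infixl 6 _⊕_
_⊕_ : Series → Series → Series
(f ⊕ g) n = f n + g n

⊛-≡-∑< : ∀ f g n → (f ⊛ g) n ≡ (∑[ i < suc n ] f i * g (n ∸ i))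
⊛-≡-∑< f g n = cong sum (map-upTo (λ i → f i * g (n ∸ i)) (suc n))

⊛-suc : ∀ f g n → (f ⊛ g) (suc n) ≡ f 0 * g (suc n) + ((f ∘ suc) ⊛ g) n
⊛-suc f g n = trans (⊛-≡-∑< f g (suc n)) (cong (f 0 * g (suc n) +_) (sym (⊛-≡-∑< (f ∘ suc) g n)))

⊛-congˡ : ∀ {f f'} g → f ≗ f' → (f ⊛ g) ≗ (f' ⊛ g)
⊛-congˡ g f≗f' n = cong sum (map-cong (λ i → cong (_* g (n ∸ i)) (f≗f' i)) (upTo (suc n)))

⊛-distribʳ-⊕ : ∀ f f' g → ((f ⊕ f') ⊛ g) ≗ ((f ⊛ g) ⊕ (f' ⊛ g))
⊛-distribʳ-⊕ f f' g n = begin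
  ((f ⊕ f') ⊛ g) n                                         ≡⟨ ⊛-≡-∑< (f ⊕ f') g n ⟩
  (∑[ i < suc n ] (f i + f' i) * g (n ∸ i))                ≡⟨ ∑<-cong (suc n) (λ {i} _ → *-distribʳ-+ (g (n ∸ i)) (f i) (f' i)) ⟩
  (∑[ i < suc n ] (f i * g (n ∸ i) + f' i * g (n ∸ i)))    ≡⟨ ∑<-distrib-+ (suc n) (λ i → f i * g (n ∸ i)) (λ i → f' i * g (n ∸ i)) ⟩
  (∑[ i < suc n ] f i * g (n ∸ i)) + (∑[ i < suc n ] f' i * g (n ∸ i))
                                                           ≡⟨ cong₂ _+_ (⊛-≡-∑< f g n) (⊛-≡-∑< f' g n) ⟨
  (f ⊛ g) n + (f' ⊛ g) n                                   ∎
  where open ≡-Reasoning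

⊛-scaleˡ : ∀ c f g n → ((λ i → c * f i) ⊛ g) n ≡ c * (f ⊛ g) n
⊛-scaleˡ c f g n = begin
  ((λ i → c * f i) ⊛ g) n                 ≡⟨ ⊛-≡-∑< (λ i → c * f i) g n ⟩
  (∑[ i < suc n ] c * f i * g (n ∸ i))    ≡⟨ ∑<-cong (suc n) (λ {i} _ → *-assoc c (f i) (g (n ∸ i))) ⟩
  (∑[ i < suc n ] c * (f i * g (n ∸ i)))  ≡⟨ *-distribˡ-∑< c (suc n) (λ i → f i * g (n ∸ i)) ⟨
  c * (∑[ i < suc n ] f i * g (n ∸ i))    ≡⟨ cong (c *_) (⊛-≡-∑< f g n) ⟨
  c * (f ⊛ g) n                           ∎
  where open ≡-Reasoning

⊛-assoc : ∀ f g h → ((f ⊛ g) ⊛ h) ≗ (f ⊛ (g ⊛ h))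
⊛-assoc f g h zero    = assoc-0 (f 0) (g 0) (h 0)
  where
  assoc-0 : ∀ a b c → (a * b + 0) * c + 0 ≡ a * (b * c + 0) + 0
  assoc-0 = solve-∀
⊛-assoc f g h (suc n) = begin
  ((f ⊛ g) ⊛ h) (suc n)
    ≡⟨ ⊛-suc (f ⊛ g) h n ⟩
  (f ⊛ g) 0 * h (suc n) + (((f ⊛ g) ∘ suc) ⊛ h) n
    ≡⟨ cong (head +_) (⊛-congˡ h (⊛-suc f g) n) ⟩
  (f ⊛ g) 0 * h (suc n) + (((λ i → f 0 * g (suc i)) ⊕ ((f ∘ suc) ⊛ g)) ⊛ h) n
    ≡⟨ cong (head +_) (⊛-distribʳ-⊕ (λ i → f 0 * g (suc i)) ((f ∘ suc) ⊛ g) h n) ⟩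
  (f ⊛ g) 0 * h (suc n) + (((λ i → f 0 * g (suc i)) ⊛ h) n + (((f ∘ suc) ⊛ g) ⊛ h) n)
    ≡⟨ cong₂ (λ x y → head + (x + y)) (⊛-scaleˡ (f 0) (g ∘ suc) h n) (⊛-assoc (f ∘ suc) g h n) ⟩
  (f 0 * g 0 + 0) * h (suc n) + (f 0 * ((g ∘ suc) ⊛ h) n + ((f ∘ suc) ⊛ (g ⊛ h)) n)
    ≡⟨ regroup (f 0) (g 0) (h (suc n)) _ _ ⟩
  f 0 * (g 0 * h (suc n) + ((g ∘ suc) ⊛ h) n) + ((f ∘ suc) ⊛ (g ⊛ h)) n
    ≡⟨ cong (λ x → f 0 * x + ((f ∘ suc) ⊛ (g ⊛ h)) n) (⊛-suc g h n) ⟨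
  f 0 * (g ⊛ h) (suc n) + ((f ∘ suc) ⊛ (g ⊛ h)) n
    ≡⟨ ⊛-suc f (g ⊛ h) n ⟨
  (f ⊛ (g ⊛ h)) (suc n)
    ∎
  where
  open ≡-Reasoning
  head : ℕ
  head = (f ⊛ g) 0 * h (suc n)
  regroup : ∀ a b c x y → (a * b + 0) * c + (a * x + y) ≡ a * (b * c + x) + y
  regroup = solve-∀

⊛-comm : ∀ f g → (f ⊛ g) ≗ (g ⊛ f)
⊛-comm f g n = begin
  (f ⊛ g) n                                       ≡⟨ ⊛-≡-∑< f g n ⟩
  (∑[ i < suc n ] f i * g (n ∸ i))                ≡⟨ ∑<-reverse (suc n) (λ i → f i * g (n ∸ i)) ⟩
  (∑[ i < suc n ] f (n ∸ i) * g (n ∸ (n ∸ i)))    ≡⟨ ∑<-cong (suc n) (λ {i} i≤n → swap i (≤-pred i≤n)) ⟩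
  (∑[ i < suc n ] g i * f (n ∸ i))                ≡⟨ ⊛-≡-∑< g f n ⟨
  (g ⊛ f) n                                       ∎
  where
  open ≡-Reasoning
  swap : ∀ i → i ≤ n → f (n ∸ i) * g (n ∸ (n ∸ i)) ≡ g i * f (n ∸ i)
  swap i i≤n = trans (cong (λ j → f (n ∸ i) * g j) (m∸[m∸n]≡n i≤n)) (*-comm (f (n ∸ i)) (g i))

qpow-⊛ : ∀ a g {n} → a ≤ n → (qpow a ⊛ g) n ≡ g (n ∸ a)
qpow-⊛ zero    g {n}     _         = begin
  (qpow 0 ⊛ g) n                         ≡⟨ ⊛-≡-∑< (qpow 0) g n ⟩
  g n + 0 + (∑[ i < n ] 0)               ≡⟨ cong (g n + 0 +_) (∑<-zero n (λ _ → refl)) ⟩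
  g n + 0 + 0                            ≡⟨ trans (+-identityʳ _) (+-identityʳ _) ⟩
  g n                                    ∎
  where open ≡-Reasoning
qpow-⊛ (suc a) g {suc n} (s≤s a≤n) = trans (⊛-suc (qpow (suc a)) g n) (qpow-⊛ a g a≤n)

qpow-⊛-< : ∀ a g {n} → n < a → (qpow a ⊛ g) n ≡ 0
qpow-⊛-< (suc a) g {zero}  _         = refl
qpow-⊛-< (suc a) g {suc n} (s<s n<a) = trans (⊛-suc (qpow (suc a)) g n) (qpow-⊛-< a g n<a)

⊛-identityˡ : ∀ g → (qpow 0 ⊛ g) ≗ g
⊛-identityˡ g n = qpow-⊛ 0 g z≤n

module Modulo (d : ℕ) .{{_ : NonZero d}} where

  infix 4 _≈_
  _≈_ : Rel Series 0ℓ
  f ≈ g = ∀ n → f n % d ≡ g n % d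

  ≗⇒≈ : ∀ {f g} → f ≗ g → f ≈ g
  ≗⇒≈ f≗g n = cong (_% d) (f≗g n)

  ≈-isEquivalence : IsEquivalence _≈_
  ≈-isEquivalence = record
    { refl  = λ _ → refl
    ; sym   = λ f≈g n → sym (f≈g n)
    ; trans = λ f≈g g≈h n → trans (f≈g n) (g≈h n)
    }

  ⊛-cong : Congruent₂ _≈_ _⊛_
  ⊛-cong {f} {f'} {g} {g'} f≈f' g≈g' n = begin
    (f ⊛ g) n % d                              ≡⟨ cong (_% d) (⊛-≡-∑< f g n) ⟩
    (∑[ i < suc n ] f i * g (n ∸ i)) % d       ≡⟨ ∑<-cong-% (suc n) (λ {i} _ → *-cong-% (f≈f' i) (g≈g' (n ∸ i))) ⟩
    (∑[ i < suc n ] f' i * g' (n ∸ i)) % d     ≡⟨ cong (_% d) (⊛-≡-∑< f' g' n) ⟨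
    (f' ⊛ g') n % d                            ∎
    where open ≡-Reasoning

  ⊛-isCommutativeMonoid : IsCommutativeMonoid _≈_ _⊛_ (qpow 0)
  ⊛-isCommutativeMonoid = record
    { isMonoid = record
      { isSemigroup = record
        { isMagma = record { isEquivalence = ≈-isEquivalence ; ∙-cong = ⊛-cong }
        ; assoc   = λ f g h → ≗⇒≈ (⊛-assoc f g h)
        }
      ; identity = (λ f → ≗⇒≈ (⊛-identityˡ f))
                 , (λ f → ≗⇒≈ (λ n → trans (⊛-comm f (qpow 0) n) (⊛-identityˡ f n)))
      }
    ; comm = λ f g → ≗⇒≈ (⊛-comm f g)
    }

  ⊛-commutativeMonoid : CommutativeMonoid 0ℓ 0ℓ
  ⊛-commutativeMonoid = record
    { Carrier = Series ; _≈_ = _≈_ ; _∙_ = _⊛_ ; ε = qpow 0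
    ; isCommutativeMonoid = ⊛-isCommutativeMonoid
    }

open Modulo 2 using () renaming (_≈_ to _≈₂_)
module Series₂ = CommutativeMonoid (Modulo.⊛-commutativeMonoid 2)
open CommutativeSemigroupProperties Series₂.commutativeSemigroup using (interchange)

onePlusQ-≗ : ∀ m → onePlusQ m ≗ (qpow 0 ⊕ qpow m)
onePlusQ-≗ zero    zero    = refl
onePlusQ-≗ zero    (suc n) = refl
onePlusQ-≗ (suc m) zero    = refl
onePlusQ-≗ (suc m) (suc n) = refl

geomInv-< : ∀ {m K} → K < suc m → geomInv (suc m) K ≡ δ K 0
geomInv-< K<1+m = cong (λ r → δ r 0) (m<n⇒m%n≡m K<1+m)

geomInv-≥ : ∀ {m K} → suc m ≤ K → geomInv (suc m) K ≡ geomInv (suc m) (K ∸ suc m)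
geomInv-≥ 1+m≤K = cong (λ r → δ r 0) (sym (m≤n⇒[n∸m]%m≡n%m 1+m≤K))

geomInv-unfold : ∀ m → geomInv (suc m) ≗ (qpow 0 ⊕ (qpow (suc m) ⊛ geomInv (suc m)))
geomInv-unfold m K with K <? suc m
... | yes K<1+m = begin
  geomInv (suc m) K                           ≡⟨ geomInv-< K<1+m ⟩
  δ K 0                                       ≡⟨ +-identityʳ (δ K 0) ⟨
  δ K 0 + 0                                   ≡⟨ cong (δ K 0 +_) (qpow-⊛-< (suc m) (geomInv (suc m)) K<1+m) ⟨
  δ K 0 + (qpow (suc m) ⊛ geomInv (suc m)) K  ∎
  where open ≡-Reasoning
... | no K≮1+m = begin
  geomInv (suc m) K                           ≡⟨ geomInv-≥ 1+m≤K ⟩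
  geomInv (suc m) (K ∸ suc m)                 ≡⟨ qpow-⊛ (suc m) (geomInv (suc m)) 1+m≤K ⟨
  (qpow (suc m) ⊛ geomInv (suc m)) K          ≡⟨ cong (_+ (qpow (suc m) ⊛ geomInv (suc m)) K) (δ-≢ K≢0) ⟨
  δ K 0 + (qpow (suc m) ⊛ geomInv (suc m)) K  ∎
  where
  open ≡-Reasoning
  1+m≤K : suc m ≤ K
  1+m≤K = ≮⇒≥ K≮1+m
  K≢0 : K ≢ 0
  K≢0 refl = K≮1+m z<s

geomInv-≡-∑δ : ∀ m L {K} → K < L → geomInv (suc m) K ≡ (∑[ t < L ] δ K (t * suc m))
geomInv-≡-∑δ m (suc L) {K} K<1+L with K <? suc m
... | yes K<1+m = begin
  geomInv (suc m) K                              ≡⟨ geomInv-< K<1+m ⟩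
  δ K 0                                          ≡⟨ +-identityʳ (δ K 0) ⟨
  δ K 0 + 0                                      ≡⟨ cong (δ K 0 +_) (∑<-zero L (λ {t} _ → δ-≢ (K≢ t))) ⟨
  δ K 0 + (∑[ t < L ] δ K (suc m + t * suc m))   ∎
  where
  open ≡-Reasoning
  K≢ : ∀ t → K ≢ suc m + t * suc m
  K≢ t K≡ = <⇒≱ K<1+m (≤-trans (m≤m+n (suc m) (t * suc m)) (≤-reflexive (sym K≡)))
... | no K≮1+m = begin
  geomInv (suc m) K                              ≡⟨ geomInv-≥ 1+m≤K ⟩
  geomInv (suc m) (K ∸ suc m)                    ≡⟨ geomInv-≡-∑δ m L (<-≤-trans (∸-monoˡ-< K<1+L 1+m≤K) (m∸n≤m L m)) ⟩
  (∑[ t < L ] δ (K ∸ suc m) (t * suc m))         ≡⟨ ∑<-cong L (λ _ → δ-cong (mk⇔ shiftˡ shiftʳ)) ⟩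
  (∑[ t < L ] δ K (suc m + t * suc m))           ≡⟨ cong (_+ (∑[ t < L ] δ K (suc m + t * suc m))) (δ-≢ K≢0) ⟨
  δ K 0 + (∑[ t < L ] δ K (suc m + t * suc m))   ∎
  where
  open ≡-Reasoning
  1+m≤K : suc m ≤ K
  1+m≤K = ≮⇒≥ K≮1+m
  K≢0 : K ≢ 0
  K≢0 refl = K≮1+m z<s
  shiftˡ : ∀ {x} → K ∸ suc m ≡ x → K ≡ suc m + x
  shiftˡ refl = sym (m+[n∸m]≡n 1+m≤K)
  shiftʳ : ∀ {x} → K ≡ suc m + x → K ∸ suc m ≡ x
  shiftʳ refl = m+n∸m≡n (suc m) _

onePlusQ-⊛-geomInv : ∀ m → (onePlusQ (suc m) ⊛ geomInv (suc m)) ≈₂ qpow 0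
onePlusQ-⊛-geomInv m K = begin
  (onePlusQ (suc m) ⊛ G) K % 2                 ≡⟨ cong (_% 2) (⊛-congˡ G (onePlusQ-≗ (suc m)) K) ⟩
  ((qpow 0 ⊕ qpow (suc m)) ⊛ G) K % 2          ≡⟨ cong (_% 2) (⊛-distribʳ-⊕ (qpow 0) (qpow (suc m)) G K) ⟩
  ((qpow 0 ⊛ G) K + X K) % 2                   ≡⟨ cong (λ y → (y + X K) % 2) (trans (⊛-identityˡ G K) (geomInv-unfold m K)) ⟩
  (qpow 0 K + X K + X K) % 2                   ≡⟨ [m+n+n]%2≡m%2 (qpow 0 K) (X K) ⟩
  qpow 0 K % 2                                 ∎
  where
  open ≡-Reasoning
  G X : Series
  G = geomInv (suc m)
  X = qpow (suc m) ⊛ G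

onePlusQ-⊛-geomInv-odd : ∀ n → (onePlusQ (2 * n + 1) ⊛ geomInv (2 * n + 1)) ≈₂ qpow 0
onePlusQ-⊛-geomInv-odd n rewrite +-comm (2 * n) 1 = onePlusQ-⊛-geomInv (2 * n)

negQPoch-⊛-invQPoch : ∀ n → (negQPoch n ⊛ invQPoch n) ≈₂ qpow 0
negQPoch-⊛-invQPoch zero    = Series₂.identityˡ (qpow 0)
negQPoch-⊛-invQPoch (suc n) = begin
  (negQPoch n ⊛ A) ⊛ (invQPoch n ⊛ G)   ≈⟨ interchange (negQPoch n) A (invQPoch n) G ⟩
  (negQPoch n ⊛ invQPoch n) ⊛ (A ⊛ G)   ≈⟨ Series₂.∙-cong {negQPoch n ⊛ invQPoch n} {qpow 0} {A ⊛ G} {qpow 0}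
                                             (negQPoch-⊛-invQPoch n) (onePlusQ-⊛-geomInv-odd n) ⟩
  qpow 0 ⊛ qpow 0                       ≈⟨ Series₂.identityˡ (qpow 0) ⟩
  qpow 0                                ∎
  where
  open SetoidReasoning Series₂.setoid
  A G : Series
  A = onePlusQ (2 * n + 1)
  G = geomInv (2 * n + 1)

term-≈₂ : ∀ n → term n ≈₂ (qpow n ⊛ geomInv (2 * n + 1))
term-≈₂ n = begin
  qpow n ⊛ (negQPoch n ⊛ (invQPoch n ⊛ G))   ≈⟨ qpowₙ⊛-cong (Series₂.assoc (negQPoch n) (invQPoch n) G) ⟨
  qpow n ⊛ ((negQPoch n ⊛ invQPoch n) ⊛ G)   ≈⟨ qpowₙ⊛-cong (Series₂.∙-congʳ {G} {negQPoch n ⊛ invQPoch n} {qpow 0} (negQPoch-⊛-invQPoch n)) ⟩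
  qpow n ⊛ (qpow 0 ⊛ G)                      ≈⟨ qpowₙ⊛-cong (Series₂.identityˡ G) ⟩
  qpow n ⊛ G                                 ∎
  where
  open SetoidReasoning Series₂.setoid
  G : Series
  G = geomInv (2 * n + 1)
  qpowₙ⊛-cong : ∀ {g g'} → g ≈₂ g' → (qpow n ⊛ g) ≈₂ (qpow n ⊛ g')
  qpowₙ⊛-cong = Series₂.∙-congˡ {qpow n}

-- For odd M < 2 L this is the number of divisors of M.
oddFactorisations : ℕ → ℕ → ℕ
oddFactorisations L M = ∑[ n < L ] ∑[ t < L ] δ M (suc (2 * n) * suc (2 * t))

geomInv-odd-≡-∑δ : ∀ {n N} → n ≤ N →
  geomInv (2 * n + 1) (N ∸ n) ≡ (∑[ t < suc N ] δ (suc (2 * N)) (suc (2 * n) * suc (2 * t)))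
geomInv-odd-≡-∑δ {n} {N} n≤N rewrite +-comm (2 * n) 1 = begin
  geomInv (suc (2 * n)) (N ∸ n)                            ≡⟨ geomInv-≡-∑δ (2 * n) (suc N) (s≤s (m∸n≤m N n)) ⟩
  (∑[ t < suc N ] δ (N ∸ n) (t * suc (2 * n)))             ≡⟨ ∑<-cong (suc N) (λ {t} _ → δ-cong (mk⇔ (to t) (from t))) ⟩
  (∑[ t < suc N ] δ (suc (2 * N)) (suc (2 * n) * suc (2 * t))) ∎
  where
  open ≡-Reasoning
  odd-product : ∀ n t → suc (2 * (t * suc (2 * n) + n)) ≡ suc (2 * n) * suc (2 * t)
  odd-product = solve-∀
  to : ∀ t → N ∸ n ≡ t * suc (2 * n) → suc (2 * N) ≡ suc (2 * n) * suc (2 * t)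
  to t eq = trans (cong (λ x → suc (2 * x)) (trans (sym (m∸n+n≡m n≤N)) (cong (_+ n) eq))) (odd-product n t)
  from : ∀ t → suc (2 * N) ≡ suc (2 * n) * suc (2 * t) → N ∸ n ≡ t * suc (2 * n)
  from t eq = trans (cong (_∸ n) (*-cancelˡ-≡ N _ 2 (suc-injective (trans eq (sym (odd-product n t))))))
                    (m+n∸n≡m _ n)

b≡oddFactorisations-mod2 : ∀ N → b N % 2 ≡ oddFactorisations (suc N) (suc (2 * N)) % 2
b≡oddFactorisations-mod2 N = begin
  b N % 2                                               ≡⟨ cong (_% 2) (cong sum (map-upTo (λ n → term n N) (suc N))) ⟩
  (∑[ n < suc N ] term n N) % 2                         ≡⟨ ∑<-cong-% (suc N) {λ n → term n N} {λ n → geomInv (2 * n + 1) (N ∸ n)}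
                                                           (λ n<1+N → term-coefficient (≤-pred n<1+N)) ⟩
  (∑[ n < suc N ] geomInv (2 * n + 1) (N ∸ n)) % 2      ≡⟨ cong (_% 2) (∑<-cong (suc N) (λ n<1+N → geomInv-odd-≡-∑δ (≤-pred n<1+N))) ⟩
  oddFactorisations (suc N) (suc (2 * N)) % 2           ∎
  where
  open ≡-Reasoning
  term-coefficient : ∀ {n} → n ≤ N → term n N % 2 ≡ geomInv (2 * n + 1) (N ∸ n) % 2
  term-coefficient {n} n≤N = trans (term-≈₂ n N) (cong (_% 2) (qpow-⊛ n (geomInv (2 * n + 1)) n≤N))

-- E = U + Uᵀ for the strict upper triangle U of E, and U, Uᵀ have the same sum.
∑∑-symmetric-even : ∀ L (E : ℕ → ℕ → ℕ) → (∀ i j → E i j ≡ E j i) → (∀ i → E i i ≡ 0) →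
                    (∑[ i < L ] ∑[ j < L ] E i j) % 2 ≡ 0
∑∑-symmetric-even L E E-sym E-diag = begin
  (∑[ i < L ] ∑[ j < L ] E i j) % 2
    ≡⟨ cong (_% 2) (∑<-cong L (λ {i} _ → ∑<-cong L (λ {j} _ → E≡U+Uᵀ i j))) ⟩
  (∑[ i < L ] ∑[ j < L ] (U i j + U j i)) % 2
    ≡⟨ cong (_% 2) (∑<-cong L (λ {i} _ → ∑<-distrib-+ L (U i) (λ j → U j i))) ⟩
  (∑[ i < L ] (∑< L (U i) + (∑[ j < L ] U j i))) % 2
    ≡⟨ cong (_% 2) (∑<-distrib-+ L (λ i → ∑< L (U i)) (λ i → ∑[ j < L ] U j i)) ⟩
  (T + (∑[ i < L ] ∑[ j < L ] U j i)) % 2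
    ≡⟨ cong (λ x → (T + x) % 2) (∑<-swap L L (λ i j → U j i)) ⟩
  (T + T) % 2
    ≡⟨ [m+n+n]%2≡m%2 0 T ⟩
  0 ∎
  where
  open ≡-Reasoning
  U : ℕ → ℕ → ℕ
  U i j with i <? j
  ... | yes _ = E i j
  ... | no  _ = 0
  T : ℕ
  T = ∑[ i < L ] ∑[ j < L ] U i j
  E≡U+Uᵀ : ∀ i j → E i j ≡ U i j + U j i
  E≡U+Uᵀ i j with i <? j | j <? i
  ... | yes i<j | yes j<i = ⊥-elim (<-asym i<j j<i)
  ... | yes _   | no  _   = sym (+-identityʳ (E i j))
  ... | no  _   | yes _   = E-sym i j
  ... | no  i≮j | no  j≮i = trans (cong (E i) (sym (≤-antisym (≮⇒≥ j≮i) (≮⇒≥ i≮j)))) (E-diag i)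

NonSquare : ℕ → Set
NonSquare M = ∀ x → x * x ≢ M

oddFactorisations-even : ∀ L {M} → NonSquare M → oddFactorisations L M % 2 ≡ 0
oddFactorisations-even L {M} M-nonsquare =
  ∑∑-symmetric-even L (λ n t → δ M (suc (2 * n) * suc (2 * t)))
    (λ n t → cong (δ M) (*-comm (suc (2 * n)) (suc (2 * t))))
    (λ n → δ-≢ (≢-sym (M-nonsquare (suc (2 * n)))))

prime>2⇒odd : ∀ {p} → Prime p → 2 < p → p % 2 ≡ 1
prime>2⇒odd {p} p-prime 2<p with p % 2 in p%2≡r | m%n<n p 2
... | 1           | _            = refl
... | suc (suc _) | s<s (s<s ())
... | 0           | _ with prime⇒irreducible p-prime (m%n≡0⇒n∣m p 2 p%2≡r)
...   | inj₂ refl = ⊥-elim (<-irrefl refl 2<p)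

odd⇒odd^ : ∀ {m} → m % 2 ≡ 1 → ∀ k → m ^ k % 2 ≡ 1
odd⇒odd^ m-odd zero    = refl
odd⇒odd^ {m} m-odd (suc k) = *-cong-% {2} {m} {1} {m ^ k} {1} m-odd (odd⇒odd^ m-odd k)

odd⇒1+2*[[m∸1]/2]≡m : ∀ {m} → m % 2 ≡ 1 → suc (2 * ((m ∸ 1) / 2)) ≡ m
odd⇒1+2*[[m∸1]/2]≡m {m} m-odd = begin
  suc (2 * ((m ∸ 1) / 2))    ≡⟨ cong (λ x → suc (2 * ((x ∸ 1) / 2))) m≡1+h*2 ⟩
  suc (2 * (m / 2 * 2 / 2))  ≡⟨ cong (λ x → suc (2 * x)) (m*n/n≡m (m / 2) 2) ⟩
  suc (2 * (m / 2))          ≡⟨ cong suc (*-comm 2 (m / 2)) ⟩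
  suc (m / 2 * 2)            ≡⟨ m≡1+h*2 ⟨
  m                          ∎
  where
  open ≡-Reasoning
  m≡1+h*2 : m ≡ suc (m / 2 * 2)
  m≡1+h*2 = trans (m≡m%n+[m/n]*n m 2) (cong (_+ m / 2 * 2) m-odd)

p∤p+6n : ∀ {p n} → Prime p → 3 < p → ¬ p ∣ n → ¬ p ∣ p + 6 * n
p∤p+6n {p} {n} p-prime p>3 p∤n p∣p+6n with euclidsLemma 6 n p-prime (∣m+n∣m⇒∣n p∣p+6n ∣-refl)
... | inj₂ p∣n = p∤n p∣n
... | inj₁ p∣6 with euclidsLemma 2 3 p-prime p∣6
...   | inj₁ p∣2 = <⇒≱ p>3 (≤-trans (∣⇒≤ p∣2) (n≤1+n 2))
...   | inj₂ p∣3 = <⇒≱ p>3 (∣⇒≤ p∣3)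

-- Descent: p ∣ x² forces p ∣ x, and dividing by p² lowers the exponent by 2.
x*x≢p^[1+2k]*u : ∀ {p u} → Prime p → ¬ p ∣ u → ∀ k x → x * x ≢ p ^ suc (2 * k) * u
x*x≢p^[1+2k]*u {p} {u} p-prime p∤u k x eq =
  descend k (reduce (euclidsLemma x x p-prime (divides (p ^ (2 * k) * u) (trans eq (rotate p _ u))))) eq
  where
  instance _ = prime⇒nonZero p-prime
  rotate : ∀ p a u → p * a * u ≡ a * u * p
  rotate = solve-∀
  square-yp : ∀ y p → y * p * (y * p) ≡ p * (p * (y * y))
  square-yp = solve-∀
  descend : ∀ k {x} → p ∣ x → x * x ≢ p ^ suc (2 * k) * u
  descend zero    (divides y refl) eq = p∤u (divides (y * y) (sym (*-cancelˡ-≡ (y * y * p) u p (begin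
    p * (y * y * p)         ≡⟨ cong (p *_) (*-comm (y * y) p) ⟩
    p * (p * (y * y))       ≡⟨ square-yp y p ⟨
    y * p * (y * p)         ≡⟨ eq ⟩
    p * 1 * u               ≡⟨ cong (_* u) (*-identityʳ p) ⟩
    p * u                   ∎))))
    where open ≡-Reasoning
  descend (suc k) (divides y refl) eq = x*x≢p^[1+2k]*u p-prime p∤u k y
    (*-cancelˡ-≡ (y * y) _ p (*-cancelˡ-≡ (p * (y * y)) _ p (begin
    p * (p * (y * y))                ≡⟨ square-yp y p ⟨
    y * p * (y * p)                  ≡⟨ eq ⟩
    p ^ suc (2 * suc k) * u          ≡⟨ cong (λ e → p ^ suc e * u) (*-suc 2 k) ⟩
    p * (p * p ^ suc (2 * k)) * u    ≡⟨ reassoc p (p ^ suc (2 * k)) u ⟩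
    p * (p * (p ^ suc (2 * k) * u))  ∎)))
    where
    open ≡-Reasoning
    reassoc : ∀ p a u → p * (p * a) * u ≡ p * (p * (a * u))
    reassoc = solve-∀

1+2N≡p^[1+2k]*[p+6n] : ∀ {p} → p % 2 ≡ 1 → ∀ k n →
  let N = 3 * p ^ (2 * k + 1) * n + (p ^ (2 * k + 2) ∸ 1) / 2 in suc (2 * N) ≡ p ^ suc (2 * k) * (p + 6 * n)
1+2N≡p^[1+2k]*[p+6n] {p} p-odd k n = begin
  suc (2 * (3 * p ^ (2 * k + 1) * n + h))    ≡⟨ regroup (p ^ (2 * k + 1)) n h ⟩
  suc (2 * h) + 6 * (p ^ (2 * k + 1) * n)    ≡⟨ cong₂ (λ a b → a + 6 * (b * n)) 1+2h≡p*Q p^[2k+1]≡Q ⟩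
  p * Q + 6 * (Q * n)                        ≡⟨ factor p Q n ⟩
  Q * (p + 6 * n)                            ∎
  where
  open ≡-Reasoning
  h Q : ℕ
  h = (p ^ (2 * k + 2) ∸ 1) / 2
  Q = p ^ suc (2 * k)
  p^[2k+1]≡Q : p ^ (2 * k + 1) ≡ Q
  p^[2k+1]≡Q = cong (p ^_) (+-comm (2 * k) 1)
  1+2h≡p*Q : suc (2 * h) ≡ p * Q
  1+2h≡p*Q = trans (odd⇒1+2*[[m∸1]/2]≡m (odd⇒odd^ p-odd (2 * k + 2))) (cong (p ^_) (+-comm (2 * k) 2))
  regroup : ∀ a n h → suc (2 * (3 * a * n + h)) ≡ suc (2 * h) + 6 * (a * n)
  regroup = solve-∀
  factor : ∀ p a n → p * a + 6 * (a * n) ≡ a * (p + 6 * n)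
  factor = solve-∀

theorem1p4 : (p : ℕ) → Prime p → 5 Data.Nat.≤ p → legendreMinus3IsMinusOne p →
    (n k : ℕ) → ¬ (p ∣ n) →
    b (3 * p ^ (2 * k + 1) * n + (p ^ (2 * k + 2) ∸ 1) / 2) % 2 ≡ 0
theorem1p4 p p-prime 5≤p _ n k p∤n =
  trans (b≡oddFactorisations-mod2 N) (oddFactorisations-even (suc N) 1+2N-nonsquare)
  where
  p>3 : p > 3
  p>3 = ≤-trans (n≤1+n 4) 5≤p
  N : ℕ
  N = 3 * p ^ (2 * k + 1) * n + (p ^ (2 * k + 2) ∸ 1) / 2
  1+2N-nonsquare : NonSquare (suc (2 * N))
  1+2N-nonsquare x eq = x*x≢p^[1+2k]*u p-prime (p∤p+6n p-prime p>3 p∤n) k x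
    (trans eq (1+2N≡p^[1+2k]*[p+6n] (prime>2⇒odd p-prime (<-trans (n<1+n 2) p>3)) k n))
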